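{- Let $T$ be a tournament on $n$ vertices, let $v\in V(T)$, and let $c\in\mathbb{N}$ satisfy $2\le c\le \log d^+(v)-1$. Then there exist disjoint sets $B,E\subseteq V(T)$ such that: (i) $2\le|B|\le c$ and $T[B]$ is a transitive tournament with tail $v$; (ii) $B$ in-dominates $V(T)\setminus(B\cup E)$; (iii) $|E|\le (1/2)^{c-1}d^+(v)$.
   Context: $\log$ is the binary logarithm; $d^+(v)$ is the out-degree of $v$ in $T$. A tournament is transitive if its vertices can be ordered $v_1,\dots,v_m$ with $v_iv_j$ an edge iff $i<j$; $v_1$ is its tail. $B$ in-dominates $Z$ if every vertex of $Z$ is an in-neighbour of some vertex of $B$. -}

module Defs where

open import Data.Nat using (ℕ; _≤_)
open import Data.Fin using (Fin)
open import Data.Fin.Subset using (Subset; _∈_; _∉_; ∣_∣; ⊤; _∩_)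
open import Data.Bool using (Bool; true; false)
open import Data.List using (List; []; _∷_)
open import Data.List.Relation.Unary.Unique.Propositional using (Unique)
open import Data.List.Relation.Unary.Linked using (Linked)
open import Data.List.Membership.Propositional as L using ()
open import Data.Product using (Σ; ∃; _×_)
open import Data.Sum using (_⊎_)
open import Relation.Binary.PropositionalEquality using (_≡_)
open import Relation.Nullary using (¬_)

record Tournament (n : ℕ) : Set₁ where
  field
    adj    : Fin n → Fin n → Set
    irrefl : ∀ i → ¬ adj i i
    asym   : ∀ i j → adj i j → ¬ adj j i
    total  : ∀ i j → ¬ i ≡ j → adj i j ⊎ adj j i
open Tournament public

-- Out-degree d⁺(v): number of out-neighbours of v.
-- The out-neighbourhood is a Subset; we state d⁺ as the size of the subset
-- exactly equal to the out-neighbourhood.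
IsOutNbhd : ∀ {n} (T : Tournament n) (v : Fin n) (N : Subset n) → Set
IsOutNbhd T v N = ∀ u → (u ∈ N → adj T v u) × (adj T v u → u ∈ N)

data Forward {n} (T : Tournament n) : List (Fin n) → Set where
  []  : Forward T []
  _∷_ : ∀ {x xs} → (∀ y → y L.∈ xs → adj T x y) → Forward T xs → Forward T (x ∷ xs)

-- T[B] is a transitive tournament with tail v: B can be ordered
-- v = v₁, v₂, …, v_m with vᵢ → vⱼ iff i < j (the "only if" is automatic in a
-- tournament by asymmetry).
TransitiveWithTail : ∀ {n} (T : Tournament n) (B : Subset n) (v : Fin n) → Set
TransitiveWithTail {n} T B v =
  Σ (List (Fin n)) λ xs →
    Σ (List (Fin n)) λ rest →
      (xs ≡ v ∷ rest) × Unique xs × (∀ u → (u ∈ B → u L.∈ xs) × (u L.∈ xs → u ∈ B))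
      × Forward T xs

InDominates : ∀ {n} (T : Tournament n) (B Z : Subset n) → Set
InDominates {n} T B Z = ∀ z → z ∈ Z → Σ (Fin n) λ b → b ∈ B × adj T z b

Disjoint : ∀ {n} → Subset n → Subset n → Set
Disjoint {n} A B = ∀ (u : Fin n) → u ∈ A → u ∉ B

-- Grow a transitive chain v = b₁ → b₂ → ⋯ greedily inside N⁺(v), keeping the
-- candidate set X of vertices beaten by every bᵢ so far: add a vertex w ∈ X
-- beating fewer than |X|/2 vertices of X and replace X by X ∩ N⁺(w). Such a w
-- exists because T[X] has only |X|(|X|-1)/2 arcs, so X at least halves at each
-- step, and every vertex dropped from X beats w, so it is in-dominated.
-- After c - 1 steps (or when X runs out) put E = X.
module Submission where

open import Defs
open import Data.Nat using (ℕ; _≤_; _+_; _*_; _∸_; _^_)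
open import Data.Nat.Logarithm using (⌊log₂_⌋)
open import Data.Fin using (Fin)
open import Data.Fin.Subset using (Subset; ∣_∣; ∁; _∪_)
open import Data.Product using (Σ; _×_)

open import Data.Bool using (Bool; true; false; _∧_)
open import Data.Fin using (zero; suc; _≟_)
open import Data.Fin.Properties using (any?)
open import Data.Fin.Subset using (_∈_; _∉_; _⊆_; _∩_; ⊥; ⁅_⁆)
open import Data.Fin.Subset.Properties
  using ( _∈?_; ∉⊥; ∣⊥∣≡0; x∈⁅x⁆; x∈⁅y⁆⇒x≡y; x∈p∩q⁺; x∈p∩q⁻; x∈p∪q⁺; x∈p∪q⁻; x∈∁p⇒x∉p
        ; ∪-identityˡ)
open import Data.List using (List; []; _∷_; length)
open import Data.List.Membership.Propositional as L using ()
open import Data.List.Relation.Unary.All as All using ()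
open import Data.List.Relation.Unary.AllPairs using ([]; _∷_)
open import Data.List.Relation.Unary.Any using (here; there)
open import Data.List.Relation.Unary.Unique.Propositional using (Unique)
open import Data.Nat using (zero; suc; _<_; z≤n; s≤s; _<?_)
open import Data.Nat.Properties
  using ( +-*-semiring; *-commutativeSemigroup; module ≤-Reasoning
        ; +-identityʳ; *-identityʳ; *-zeroʳ; ≤-reflexive; <⇒≤; ≮⇒≥; <-irrefl; n≤0⇒n≡0
        ; +-mono-≤; +-monoˡ-≤; +-monoʳ-<; *-monoʳ-≤)
open import Data.Nat.Solver using (module +-*-Solver)
open import Algebra.Properties.CommutativeSemigroup *-commutativeSemigroup using (x∙yz≈y∙xz)
open import Algebra.Properties.Semiring.Sum +-*-semiring
  using (sum; sum-syntax; ∑-comm; ∑-distrib-+; *-distribˡ-sum; *-distribʳ-sum; sum-cong-≗; sum-replicate-zero)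
open import Data.Product using (∃; _,_; proj₁; proj₂)
open import Data.Sum using (_⊎_; inj₁; inj₂)
open import Data.Vec as Vec using ([]; _∷_; lookup; tabulate)
open import Data.Vec.Properties using (lookup∘tabulate; lookup-zipWith; lookup⇒[]=; []=⇒lookup)
open import Function using (_∘_)
open import Relation.Binary using (Decidable)
open import Relation.Binary.PropositionalEquality
  using (_≡_; refl; sym; trans; cong; cong₂; subst; module ≡-Reasoning)
open import Relation.Nullary using (¬_; does; yes; no; contradiction; _×-dec_)
open import Relation.Nullary.Decidable using (dec-true; dec-false)

𝟙 : Bool → ℕ
𝟙 true  = 1
𝟙 false = 0

𝟙-∧ : ∀ a b → 𝟙 (a ∧ b) ≡ 𝟙 a * 𝟙 b
𝟙-∧ true  b = sym (+-identityʳ (𝟙 b))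
𝟙-∧ false b = refl

𝟙-idem : ∀ a → 𝟙 a * 𝟙 a ≡ 𝟙 a
𝟙-idem true  = refl
𝟙-idem false = refl

∑-mono-≤ : ∀ {n} {f g : Fin n → ℕ} → (∀ i → f i ≤ g i) → sum f ≤ sum g
∑-mono-≤ {zero}  _   = z≤n
∑-mono-≤ {suc n} f≤g = +-mono-≤ (f≤g zero) (∑-mono-≤ (f≤g ∘ suc))

∑∑-distrib-+ : ∀ {m n} (f g : Fin m → Fin n → ℕ) →
  ∑[ i < m ] ∑[ j < n ] (f i j + g i j) ≡ ∑[ i < m ] ∑[ j < n ] f i j + ∑[ i < m ] ∑[ j < n ] g i j
∑∑-distrib-+ {m} {n} f g = trans
  (sum-cong-≗ {m} (λ i → ∑-distrib-+ (f i) (g i)))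
  (∑-distrib-+ (λ i → ∑[ j < n ] f i j) (λ i → ∑[ j < n ] g i j))

∑-sift : ∀ {n} (f : Fin n → ℕ) (w : Fin n) → ∑[ u < n ] (f u * 𝟙 (does (w ≟ u))) ≡ f w
∑-sift {suc n} f zero = trans (cong₂ _+_ (*-identityʳ (f zero)) vanish) (+-identityʳ (f zero))
  where
  vanish : ∑[ u < n ] (f (suc u) * 0) ≡ 0
  vanish = trans (sum-cong-≗ {n} (λ u → *-zeroʳ (f (suc u)))) (sum-replicate-zero n)
∑-sift {suc n} f (suc w) = trans
  (cong (_+ ∑[ u < n ] (f (suc u) * 𝟙 (does (w ≟ u)))) (*-zeroʳ (f zero)))
  (∑-sift (f ∘ suc) w)

∣p∣≡∑𝟙 : ∀ {n} (p : Subset n) → ∣ p ∣ ≡ ∑[ i < n ] 𝟙 (lookup p i)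
∣p∣≡∑𝟙 []          = refl
∣p∣≡∑𝟙 (true ∷ p)  = cong suc (∣p∣≡∑𝟙 p)
∣p∣≡∑𝟙 (false ∷ p) = ∣p∣≡∑𝟙 p

0<⌊log₂n⌋⇒0<n : ∀ m {j} → suc j ≤ ⌊log₂ m ⌋ → 0 < m
0<⌊log₂n⌋⇒0<n (suc _) _ = s≤s z≤n

toSubset : ∀ {n} → List (Fin n) → Subset n
toSubset []       = ⊥
toSubset (x ∷ xs) = ⁅ x ⁆ ∪ toSubset xs

∈-toSubset⁺ : ∀ {n} {u : Fin n} {xs} → u L.∈ xs → u ∈ toSubset xs
∈-toSubset⁺ (here refl) = x∈p∪q⁺ (inj₁ (x∈⁅x⁆ _))
∈-toSubset⁺ (there u∈)  = x∈p∪q⁺ (inj₂ (∈-toSubset⁺ u∈))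

∈-toSubset⁻ : ∀ {n} {u : Fin n} xs → u ∈ toSubset xs → u L.∈ xs
∈-toSubset⁻ []       u∈ = contradiction u∈ ∉⊥
∈-toSubset⁻ (x ∷ xs) u∈ with x∈p∪q⁻ ⁅ x ⁆ (toSubset xs) u∈
... | inj₁ u∈⁅x⁆ = here (x∈⁅y⁆⇒x≡y x u∈⁅x⁆)
... | inj₂ u∈xs  = there (∈-toSubset⁻ xs u∈xs)

∣⁅x⁆∪p∣≡1+∣p∣ : ∀ {n} {x : Fin n} (p : Subset n) → x ∉ p → ∣ ⁅ x ⁆ ∪ p ∣ ≡ suc ∣ p ∣
∣⁅x⁆∪p∣≡1+∣p∣ {x = zero}  (true  ∷ p) x∉p = contradiction Vec.here x∉p
∣⁅x⁆∪p∣≡1+∣p∣ {x = zero}  (false ∷ p) _   = cong (suc ∘ ∣_∣) (∪-identityˡ p)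
∣⁅x⁆∪p∣≡1+∣p∣ {x = suc x} (true  ∷ p) x∉p = cong suc (∣⁅x⁆∪p∣≡1+∣p∣ p (x∉p ∘ Vec.there))
∣⁅x⁆∪p∣≡1+∣p∣ {x = suc x} (false ∷ p) x∉p = ∣⁅x⁆∪p∣≡1+∣p∣ p (x∉p ∘ Vec.there)

∣toSubset∣≡length : ∀ {n} {xs : List (Fin n)} → Unique xs → ∣ toSubset xs ∣ ≡ length xs
∣toSubset∣≡length {n} {[]}     []            = ∣⊥∣≡0 n
∣toSubset∣≡length {n} {x ∷ xs} (x∉xs ∷ uniq) =
  trans (∣⁅x⁆∪p∣≡1+∣p∣ (toSubset xs) (λ x∈ → All.lookup x∉xs (∈-toSubset⁻ xs x∈) refl))
        (cong suc (∣toSubset∣≡length uniq))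

module _ {n} (T : Tournament n) where

  _→?_ : Decidable (adj T)
  w →? u with w ≟ u
  ... | yes refl = no (irrefl T w)
  ... | no w≢u with total T w u w≢u
  ...   | inj₁ w→u = yes w→u
  ...   | inj₂ u→w = no (asym T u w u→w)

  out : Fin n → Subset n
  out w = tabulate (λ u → does (w →? u))

  out-isOutNbhd : ∀ w → IsOutNbhd T w (out w)
  out-isOutNbhd w u = adj-of-∈ , ∈-of-adj
    where
    adj-of-∈ : u ∈ out w → adj T w u
    adj-of-∈ u∈ with w →? u | trans (sym (lookup∘tabulate _ u)) ([]=⇒lookup u∈)
    ... | yes w→u | _  = w→u
    ... | no _    | ()
    ∈-of-adj : adj T w u → u ∈ out w
    ∈-of-adj w→u = lookup⇒[]= u (out w) (trans (lookup∘tabulate _ u) (dec-true (w →? u) w→u))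

  trichotomy : ∀ w u → w ≡ u ⊎ adj T w u ⊎ adj T u w
  trichotomy w u with w ≟ u
  ... | yes w≡u = inj₁ w≡u
  ... | no w≢u  = inj₂ (total T w u w≢u)

  𝟙-trichotomy : ∀ w u → 𝟙 (does (w →? u)) + 𝟙 (does (u →? w)) + 𝟙 (does (w ≟ u)) ≡ 1
  𝟙-trichotomy w u with trichotomy w u
  ... | inj₁ refl
    rewrite dec-false (w →? w) (irrefl T w) | dec-true (w ≟ w) refl = refl
  ... | inj₂ (inj₁ w→u)
    rewrite dec-true (w →? u) w→u | dec-false (u →? w) (asym T w u w→u)
          | dec-false (w ≟ u) (λ { refl → irrefl T w w→u }) = refl
  ... | inj₂ (inj₂ u→w)
    rewrite dec-false (w →? u) (asym T u w u→w) | dec-true (u →? w) u→w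
          | dec-false (w ≟ u) (λ { refl → irrefl T w u→w }) = refl

  arcs : Subset n → ℕ
  arcs X = ∑[ w < n ] (𝟙 (lookup X w) * ∣ X ∩ out w ∣)

  ∣∩out∣≡∑ : ∀ X w → ∣ X ∩ out w ∣ ≡ ∑[ u < n ] (𝟙 (lookup X u) * 𝟙 (does (w →? u)))
  ∣∩out∣≡∑ X w = trans (∣p∣≡∑𝟙 (X ∩ out w)) (sum-cong-≗ {n} lookup-∩-out)
    where
    lookup-∩-out : ∀ u → 𝟙 (lookup (X ∩ out w) u) ≡ 𝟙 (lookup X u) * 𝟙 (does (w →? u))
    lookup-∩-out u = trans
      (cong 𝟙 (trans (lookup-zipWith _∧_ u X (out w)) (cong (lookup X u ∧_) (lookup∘tabulate _ u))))
      (𝟙-∧ (lookup X u) (does (w →? u)))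

  -- Each pair (w, u) ∈ X × X is counted once: as w → u, as u → w, or as w = u.
  handshake : ∀ X → 2 * arcs X + ∣ X ∣ ≡ ∣ X ∣ * ∣ X ∣
  handshake X = begin
    2 * arcs X + m
      ≡⟨ cong₂ _+_ (cong₂ _+_ arcs≡∑∑ (trans (+-identityʳ _) (trans arcs≡∑∑ (∑-comm a)))) m≡∑∑ ⟩
    ∑∑ a + ∑∑ (λ w u → a u w) + ∑∑ d
      ≡⟨ trans (∑∑-distrib-+ (λ w u → a w u + a u w) d) (cong (_+ ∑∑ d) (∑∑-distrib-+ a (λ w u → a u w))) ⟨
    ∑∑ (λ w u → a w u + a u w + d w u)
      ≡⟨ sum-cong-≗ {n} (λ w → sum-cong-≗ {n} (pair w)) ⟩
    ∑∑ (λ w u → χ w * χ u)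
      ≡⟨ sum-cong-≗ {n} (λ w → sym (trans (cong (χ w *_) (∣p∣≡∑𝟙 X)) (*-distribˡ-sum (χ w) χ))) ⟩
    ∑[ w < n ] (χ w * m)
      ≡⟨ sym (*-distribʳ-sum m χ) ⟩
    (∑[ w < n ] χ w) * m
      ≡⟨ cong (_* m) (sym (∣p∣≡∑𝟙 X)) ⟩
    m * m ∎
    where
    open ≡-Reasoning
    open +-*-Solver
    m = ∣ X ∣
    χ : Fin n → ℕ
    χ u = 𝟙 (lookup X u)
    ∑∑ : (Fin n → Fin n → ℕ) → ℕ
    ∑∑ f = ∑[ w < n ] ∑[ u < n ] f w u
    a d : Fin n → Fin n → ℕ
    a w u = χ w * (χ u * 𝟙 (does (w →? u)))
    d w u = χ w * (χ u * 𝟙 (does (w ≟ u)))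
    arcs≡∑∑ : arcs X ≡ ∑∑ a
    arcs≡∑∑ = sum-cong-≗ {n} (λ w →
      trans (cong (χ w *_) (∣∩out∣≡∑ X w)) (*-distribˡ-sum (χ w) (λ u → χ u * 𝟙 (does (w →? u)))))
    m≡∑∑ : m ≡ ∑∑ d
    m≡∑∑ = begin
      m                                        ≡⟨ ∣p∣≡∑𝟙 X ⟩
      ∑[ w < n ] χ w                           ≡⟨ sum-cong-≗ {n} (λ w → sym (𝟙-idem (lookup X w))) ⟩
      ∑[ w < n ] (χ w * χ w)                   ≡⟨ sum-cong-≗ {n} (λ w → cong (χ w *_) (sym (∑-sift χ w))) ⟩
      ∑[ w < n ] (χ w * ∑[ u < n ] (χ u * 𝟙 (does (w ≟ u))))
        ≡⟨ sum-cong-≗ {n} (λ w → *-distribˡ-sum (χ w) (λ u → χ u * 𝟙 (does (w ≟ u)))) ⟩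
      ∑∑ d ∎
    pair : ∀ w u → a w u + a u w + d w u ≡ χ w * χ u
    pair w u = trans
      (solve 5 (λ x y b b′ e → x :* (y :* b) :+ y :* (x :* b′) :+ x :* (y :* e) := x :* y :* (b :+ b′ :+ e))
             refl (χ w) (χ u) _ _ _)
      (trans (cong (χ w * χ u *_) (𝟙-trichotomy w u)) (*-identityʳ _))

  fewer-than-half : ∀ X → 0 < ∣ X ∣ → ∃ λ w → w ∈ X × 2 * ∣ X ∩ out w ∣ < ∣ X ∣
  fewer-than-half X 0<m with any? (λ w → (w ∈? X) ×-dec (2 * ∣ X ∩ out w ∣ <? ∣ X ∣))
  ... | yes found = found
  ... | no none   = contradiction (begin-strict
    2 * arcs X                                    ≡⟨ +-identityʳ _ ⟨
    2 * arcs X + 0                                <⟨ +-monoʳ-< (2 * arcs X) 0<m ⟩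
    2 * arcs X + m                                ≡⟨ handshake X ⟩
    m * m                                         ≡⟨ cong (_* m) (∣p∣≡∑𝟙 X) ⟩
    (∑[ w < n ] χ w) * m                          ≡⟨ *-distribʳ-sum m χ ⟩
    ∑[ w < n ] (χ w * m)                          ≤⟨ ∑-mono-≤ weighted ⟩
    ∑[ w < n ] (χ w * (2 * ∣ X ∩ out w ∣))        ≡⟨ sum-cong-≗ {n} (λ w → x∙yz≈y∙xz (χ w) 2 _) ⟩
    ∑[ w < n ] (2 * (χ w * ∣ X ∩ out w ∣))        ≡⟨ *-distribˡ-sum 2 (λ w → χ w * ∣ X ∩ out w ∣) ⟨
    2 * arcs X                                    ∎) (<-irrefl refl)
    where
    open ≤-Reasoning
    m = ∣ X ∣
    χ : Fin n → ℕ
    χ u = 𝟙 (lookup X u)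
    weighted : ∀ w → 𝟙 (lookup X w) * m ≤ 𝟙 (lookup X w) * (2 * ∣ X ∩ out w ∣)
    weighted w with lookup X w in w∈X
    ... | false = z≤n
    ... | true  = +-monoˡ-≤ 0 (≮⇒≥ (λ lt → none (w , lookup⇒[]= w X w∈X , lt)))

  -- Fewer than k steps are taken only when the
  -- candidates run out, so small holds with the full budget k.
  record Chain (k : ℕ) (X : Subset n) : Set where
    field
      path       : List (Fin n)
      forward    : Forward T path
      unique     : Unique path
      path⊆X     : ∀ {u} → u L.∈ path → u ∈ X
      length≤    : length path ≤ k
      leftover   : Subset n
      leftover⊆X : leftover ⊆ X
      beaten     : ∀ {u b} → u ∈ leftover → b L.∈ path → adj T b u
      dominated  : ∀ {u} → u ∈ X → ¬ u L.∈ path → u ∉ leftover → ∃ λ b → b L.∈ path × adj T u b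
      small      : ∣ leftover ∣ * 2 ^ k ≤ ∣ X ∣

  emptyChain : ∀ k X → ∣ X ∣ * 2 ^ k ≤ ∣ X ∣ → Chain k X
  emptyChain k X bound = record
    { path = [] ; forward = [] ; unique = [] ; path⊆X = λ () ; length≤ = z≤n
    ; leftover = X ; leftover⊆X = λ u∈ → u∈ ; beaten = λ _ ()
    ; dominated = λ u∈X _ u∉X → contradiction u∈X u∉X ; small = bound }

  extend : ∀ {k X w} → w ∈ X → 2 * ∣ X ∩ out w ∣ < ∣ X ∣ → Chain k (X ∩ out w) → Chain (suc k) X
  extend {k} {X} {w} w∈X halves c = record
    { path = w ∷ path
    ; forward = (λ y y∈ → beats (path⊆X y∈)) ∷ forward
    ; unique = All.tabulate (λ y∈ w≡y → irrefl T w (subst (adj T w) (sym w≡y) (beats (path⊆X y∈))))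
               ∷ unique
    ; path⊆X = λ { (here refl) → w∈X ; (there y∈) → proj₁ (x∈p∩q⁻ X (out w) (path⊆X y∈)) }
    ; length≤ = s≤s length≤
    ; leftover = leftover
    ; leftover⊆X = proj₁ ∘ x∈p∩q⁻ X (out w) ∘ leftover⊆X
    ; beaten = λ { u∈ (here refl) → beats (leftover⊆X u∈) ; u∈ (there b∈) → beaten u∈ b∈ }
    ; dominated = dominated′
    ; small = begin
        ∣ leftover ∣ * (2 * 2 ^ k)  ≡⟨ x∙yz≈y∙xz ∣ leftover ∣ 2 (2 ^ k) ⟩
        2 * (∣ leftover ∣ * 2 ^ k)  ≤⟨ *-monoʳ-≤ 2 small ⟩
        2 * ∣ X ∩ out w ∣           ≤⟨ <⇒≤ halves ⟩
        ∣ X ∣                        ∎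
    }
    where
    open Chain c
    open ≤-Reasoning
    beats : ∀ {u} → u ∈ X ∩ out w → adj T w u
    beats u∈ = proj₁ (out-isOutNbhd w _) (proj₂ (x∈p∩q⁻ X (out w) u∈))
    dominated′ : ∀ {u} → u ∈ X → ¬ u L.∈ w ∷ path → u ∉ leftover →
                 ∃ λ b → b L.∈ w ∷ path × adj T u b
    dominated′ {u} u∈X u∉ u∉E with u ∈? (X ∩ out w)
    ... | yes u∈X′ = let (b , b∈ , u→b) = dominated u∈X′ (u∉ ∘ there) u∉E
                     in b , there b∈ , u→b
    ... | no u∉X′ with total T u w (λ u≡w → u∉ (here u≡w))
    ...   | inj₁ u→w = w , here refl , u→w
    ...   | inj₂ w→u = contradiction (x∈p∩q⁺ (u∈X , proj₂ (out-isOutNbhd w u) w→u)) u∉X′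

  greedy : ∀ k X → Chain k X
  greedy zero    X = emptyChain zero X (≤-reflexive (*-identityʳ ∣ X ∣))
  greedy (suc k) X with 0 <? ∣ X ∣
  ... | yes 0<m = let (w , w∈X , halves) = fewer-than-half X 0<m
                  in extend w∈X halves (greedy k (X ∩ out w))
  ... | no ¬0<m =
    emptyChain (suc k) X (subst (λ m → m * 2 ^ suc k ≤ m) (sym (n≤0⇒n≡0 (≮⇒≥ ¬0<m))) z≤n)

module TailedChain {n} (T : Tournament n) {v : Fin n} {N : Subset n} (N-out : IsOutNbhd T v N)
                   {k} (c : Chain T k N) where
  open Chain c

  B : Subset n
  B = toSubset (v ∷ path)

  ∈B⁺ : ∀ {u} → u L.∈ v ∷ path → u ∈ B
  ∈B⁺ = ∈-toSubset⁺

  v∉N : v ∉ N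
  v∉N = irrefl T v ∘ proj₁ (N-out v)

  tail-unique : Unique (v ∷ path)
  tail-unique = All.tabulate (λ u∈ v≡u → v∉N (subst (_∈ N) (sym v≡u) (path⊆X u∈))) ∷ unique

  ∣B∣≡1+length : ∣ B ∣ ≡ suc (length path)
  ∣B∣≡1+length = ∣toSubset∣≡length tail-unique

  B-transitive : TransitiveWithTail T B v
  B-transitive =
    v ∷ path , path , refl , tail-unique ,
    (λ u → ∈-toSubset⁻ (v ∷ path) , ∈B⁺) ,
    (λ y y∈ → proj₁ (N-out y) (path⊆X y∈)) ∷ forward

  B-disjoint : Disjoint B leftover
  B-disjoint u u∈B u∈E with ∈-toSubset⁻ (v ∷ path) u∈B
  ... | here refl = v∉N (leftover⊆X u∈E)
  ... | there u∈  = irrefl T u (beaten u∈E u∈)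

  in-dominated : ∀ {z} → z ∉ B → z ∉ leftover → Σ (Fin n) λ b → b ∈ B × adj T z b
  in-dominated {z} z∉B z∉E with z ∈? N
  ... | yes z∈N = let (b , b∈ , z→b) = dominated z∈N (z∉B ∘ ∈B⁺ ∘ there) z∉E
                  in b , ∈B⁺ (there b∈) , z→b
  ... | no z∉N with total T z v (λ z≡v → z∉B (∈B⁺ (here z≡v)))
  ...   | inj₁ z→v = v , ∈B⁺ (here refl) , z→v
  ...   | inj₂ v→z = contradiction (proj₂ (N-out z) v→z) z∉N

  B-dominates : InDominates T B (∁ (B ∪ leftover))
  B-dominates z z∈ = in-dominated (z∉ ∘ x∈p∪q⁺ ∘ inj₁) (z∉ ∘ x∈p∪q⁺ ∘ inj₂)
    where z∉ = x∈∁p⇒x∉p z∈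

lemma8p4 : ∀ {n} (T : Tournament n) (v : Fin n) (c : ℕ) (N : Subset n) →
    IsOutNbhd T v N →
    2 ≤ c → c + 1 ≤ ⌊log₂ ∣ N ∣ ⌋ →
    Σ (Subset n) λ B → Σ (Subset n) λ E →
    Disjoint B E
    × (2 ≤ ∣ B ∣ × ∣ B ∣ ≤ c × TransitiveWithTail T B v)
    × InDominates T B (∁ (B ∪ E))
    × ∣ E ∣ * 2 ^ (c ∸ 1) ≤ ∣ N ∣
lemma8p4 T v (suc (suc k)) N N-out (s≤s (s≤s z≤n)) log-bound =
  B , leftover , B-disjoint ,
  (subst (2 ≤_) (sym ∣B∣≡1+length) (s≤s (s≤s z≤n)) ,
   subst (_≤ suc (suc k)) (sym ∣B∣≡1+length) (s≤s length≤) ,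
   B-transitive) ,
  B-dominates , small
  where
  chain : Chain T (suc k) N
  chain = let (w , w∈N , halves) = fewer-than-half T N (0<⌊log₂n⌋⇒0<n ∣ N ∣ log-bound)
          in extend T w∈N halves (greedy T k (N ∩ out T w))
  open Chain chain
  open TailedChain T N-out chain
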